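{- Let $H$ be a graph, let $G'$ be a minimal obstruction to $H$-coloring, and let $G$ be an $H$-colorable induced subgraph of $G'$. Let $U,W\subseteq V(G)$ be two non-empty disjoint vertex subsets and let $J:=\mathsf{hull}(G-U,H)$. If there exists an isomorphism $\phi: G[U]\to J[W]$ such that $N_G(u)\setminus U\subseteq N_J(\phi(u))$ for all $u\in U$, then there exists a vertex $x\in V(G')\setminus V(G)$ such that $x$ is adjacent to some vertex $u\in U$, but $x$ is not adjacent to $\phi(u)$ in $\mathsf{hull}(G'-U,H)$ (and thus also not adjacent to $\phi(u)$ in $\mathsf{hull}(G'[(V(G)\cup\{x\})\setminus U],H)$).
   Context: All graphs are finite and simple. For graphs $G$ and $H$, an $H$-coloring of $G$ is a map $c: V(G)\to V(H)$ such that $c(u)c(v)\in E(H)$ for every edge $uv\in E(G)$; $G$ is $H$-colorable if such a map exists. A graph $G'$ is a minimal obstruction to $H$-coloring if $G'$ has no $H$-coloring but every proper induced subgraph of $G'$ has an $H$-coloring. For $U\subseteq V(G)$, $G[U]$ is the induced subgraph on $U$ and $G-U=G[V(G)\setminus U]$; $N_G(u)$ is the neighborhood of $u$ in $G$. For graphs $G,H$ such that $G$ is $H$-colorable, $\mathsf{hull}(G,H)$ is the graph with vertex set $V(G)$ in which $uv$ is an edge if and only if $c(u)c(v)\in E(H)$ for every $H$-coloring $c$ of $G$. -}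

module Defs where

open import Data.Nat using (ℕ)
open import Data.Bool using (Bool; true; false)
open import Data.Fin using (Fin)
open import Data.Fin.Subset using (Subset; _∈_; _∉_; _⊆_; _─_; _∪_; ⁅_⁆; ⊤; Nonempty)
open import Data.Product using (Σ; ∃; _×_)
open import Relation.Binary.PropositionalEquality using (_≡_)
open import Relation.Nullary using (¬_)
open import Function.Bundles using (_⇔_)

record Graph : Set where
  field
    n      : ℕ
    adj    : Fin n → Fin n → Bool
    sym    : ∀ u v → adj u v ≡ adj v u
    irrefl : ∀ v → adj v v ≡ false

open Graph public

V : Graph → Set
V G = Fin (n G)

Adj : (G : Graph) → V G → V G → Set
Adj G u v = adj G u v ≡ true

-- Induced subgraphs of a graph G are given by vertex subsets S ⊆ V(G).
record HColoring (G : Graph) (S : Subset (n G)) (H : Graph) : Set where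
  field
    col  : (v : V G) → v ∈ S → V H
    hom  : ∀ u v (hu : u ∈ S) (hv : v ∈ S) → Adj G u v → Adj H (col u hu) (col v hv)

open HColoring public

Colorable : (G : Graph) → Subset (n G) → Graph → Set
Colorable G S H = HColoring G S H

MinimalObstruction : (G H : Graph) → Set
MinimalObstruction G H =
  ¬ Colorable G ⊤ H ×
  (∀ (S : Subset (n G)) → (∃ λ v → v ∉ S) → Colorable G S H)

HullAdj : (G : Graph) → Subset (n G) → (H : Graph) → V G → V G → Set
HullAdj G S H u v =
  u ∈ S × v ∈ S ×
  (∀ (c : HColoring G S H) (hu : u ∈ S) (hv : v ∈ S) → Adj H (col c u hu) (col c v hv))

{-# OPTIONS --safe #-}
-- Colour G′ − U, which is possible by minimality, and give each u ∈ U the colour of φ(u).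
-- The hypotheses on φ make every edge inside U, and every edge from U into S, properly
-- coloured, and edges avoiding U are coloured by the colouring of G′ − U. Since G′ has no
-- H-colouring, some edge xu with u ∈ U and x ∉ S must be violated, i.e. this colouring of
-- G′ − U maps x φ(u) to a non-edge of H, and so does its restriction to any subset.
module Submission where

open import Defs
open import Data.Fin.Subset using (Subset; _∈_; _∉_; _⊆_; _─_; _∪_; ⁅_⁆; ⊤; Nonempty)
open import Data.Product using (Σ; ∃; ∃₂; _×_; _,_; proj₁; proj₂)
open import Relation.Binary.PropositionalEquality using (_≡_; refl; trans; cong; subst₂) renaming (sym to sym≡)
open import Relation.Nullary using (¬_; Dec; yes; no; contradiction)
open import Relation.Nullary.Decidable using (_→-dec_)
open import Function.Bundles using (_⇔_; Equivalence)

open import Data.Bool.Base using (true)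
open import Data.Bool.Properties using (_≟_)
open import Data.Fin.Properties using (all?; ¬∀⟶∃¬)
open import Data.Fin.Subset.Properties using (_∈?_; ∈⊤; x∈p∧x∉q⇒x∈p─q)
open import Data.Vec.Base using (_∷_; there)
open import Data.Vec.Properties.WithK using ([]=-irrelevant)

x∈p─q⇒x∉q : ∀ {k} {p q : Subset k} {x} → x ∈ p ─ q → x ∉ q
x∈p─q⇒x∉q {p = _ ∷ _} {q = _ ∷ _} (there x∈p─q) (there x∈q) = x∈p─q⇒x∉q x∈p─q x∈q

p─q⊆⊤─q : ∀ {k} {p q : Subset k} → p ─ q ⊆ ⊤ ─ q
p─q⊆⊤─q x∈p─q = x∈p∧x∉q⇒x∈p─q ∈⊤ (x∈p─q⇒x∉q x∈p─q)

Adj? : (G : Graph) (u v : V G) → Dec (Adj G u v)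
Adj? G u v = adj G u v ≟ true

Adj-sym : (G : Graph) {u v : V G} → Adj G u v → Adj G v u
Adj-sym G {u} {v} = trans (sym G v u)

module _ {G H : Graph} {T : Subset (n G)} (c : HColoring G T H) where

  col-irrelevant : ∀ {v} (h h′ : v ∈ T) → col c v h ≡ col c v h′
  col-irrelevant h h′ = cong (col c _) ([]=-irrelevant h h′)

  restrict : ∀ {T′} → T′ ⊆ T → HColoring G T′ H
  restrict T′⊆T = record
    { col = λ v h → col c v (T′⊆T h)
    ; hom = λ u v hu hv → hom c u v (T′⊆T hu) (T′⊆T hv)
    }

HullAdj⇒Adj : ∀ {G H T T′ u v} → T ⊆ T′ → HullAdj G T H u v →
              (c : HColoring G T′ H) (hu : u ∈ T′) (hv : v ∈ T′) →
              Adj H (col c u hu) (col c v hv)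
HullAdj⇒Adj {H = H} T⊆T′ (hu₀ , hv₀ , preserved) c hu hv =
  subst₂ (Adj H) (col-irrelevant c _ hu) (col-irrelevant c _ hv)
    (preserved (restrict c T⊆T′) hu₀ hv₀)

IsHom : (G H : Graph) → (V G → V H) → Set
IsHom G H f = ∀ u v → Adj G u v → Adj H (f u) (f v)

IsHom⇒HColoring : ∀ {G H f} (S : Subset (n G)) → IsHom G H f → HColoring G S H
IsHom⇒HColoring {f = f} S f-hom = record
  { col = λ v _ → f v
  ; hom = λ u v _ _ → f-hom u v
  }

¬IsHom⇒violated-edge : ∀ {G H f} → ¬ IsHom G H f →
                       ∃₂ λ u v → Adj G u v × ¬ Adj H (f u) (f v)
¬IsHom⇒violated-edge {G} {H} {f} ¬hom
  with u , ¬hom-at-u ← ¬∀⟶∃¬ _ _ (λ u → all? (λ v → Adj? G u v →-dec Adj? H (f u) (f v))) ¬hom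
  with v , ¬preserved ← ¬∀⟶∃¬ _ _ (λ v → Adj? G u v →-dec Adj? H (f u) (f v)) ¬hom-at-u
  with Adj? G u v
... | yes e  = u , v , e , λ e′ → ¬preserved (λ _ → e′)
... | no ¬e = contradiction (λ e → contradiction e ¬e) ¬preserved

module Folding {G H : Graph} {U : Subset (n G)} (c : HColoring G (⊤ ─ U) H)
               (φ : (u : V G) → u ∈ U → V G) (φ∉U : ∀ u (hu : u ∈ U) → φ u hu ∉ U) where

  κ : (v : V G) → v ∉ U → V H
  κ v v∉U = col c v (x∈p∧x∉q⇒x∈p─q ∈⊤ v∉U)

  fold : V G → V H
  fold v with v ∈? U
  ... | yes hv  = κ (φ v hv) (φ∉U v hv)
  ... | no v∉U = κ v v∉U

  fold-∈ : ∀ {u} (hu : u ∈ U) → fold u ≡ κ (φ u hu) (φ∉U u hu)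
  fold-∈ {u} hu with u ∈? U
  ... | yes hu′ rewrite []=-irrelevant hu′ hu = refl
  ... | no u∉U = contradiction hu u∉U

  fold-∉ : ∀ {v} (v∉U : v ∉ U) → fold v ≡ κ v v∉U
  fold-∉ {v} v∉U with v ∈? U
  ... | yes hv   = contradiction hv v∉U
  ... | no v∉U′ = col-irrelevant c _ _

  HullAdj⇒Adj-κ : ∀ {T a b} → HullAdj G (T ─ U) H a b → (a∉U : a ∉ U) (b∉U : b ∉ U) →
                  Adj H (κ a a∉U) (κ b b∉U)
  HullAdj⇒Adj-κ hull _ _ = HullAdj⇒Adj p─q⊆⊤─q hull c _ _

module _ {H G : Graph} (mo : MinimalObstruction G H)
         {S U : Subset (n G)} (U⊆S : U ⊆ S) (U≢∅ : Nonempty U)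
         (φ : (u : V G) → u ∈ U → V G) (φ∉U : ∀ u (hu : u ∈ U) → φ u hu ∉ U)
         (edge⇒hull : ∀ u v (hu : u ∈ U) (hv : v ∈ U) → Adj G u v →
                      HullAdj G (S ─ U) H (φ u hu) (φ v hv))
         (neighbour⇒hull : ∀ u (hu : u ∈ U) v → v ∈ S → v ∉ U → Adj G u v →
                           HullAdj G (S ─ U) H (φ u hu) v) where

  private
    c : HColoring G (⊤ ─ U) H
    c = proj₂ mo (⊤ ─ U) (proj₁ U≢∅ , λ h → x∈p─q⇒x∉q h (proj₂ U≢∅))

  open Folding c φ φ∉U

  ViolatedOutsideEdge : Set
  ViolatedOutsideEdge = ∃ λ x → x ∉ S × ∃ λ u → Σ (u ∈ U) λ hu →
                        Adj G x u × ¬ Adj H (fold x) (fold u)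

  violated-edge-from-U⇒outside : ∀ {u v} → u ∈ U → v ∉ U → Adj G u v →
                                 ¬ Adj H (fold u) (fold v) → ViolatedOutsideEdge
  violated-edge-from-U⇒outside {u} {v} hu v∉U e ¬e with v ∈? S
  ... | no v∉S = v , v∉S , u , hu , Adj-sym G e , λ e′ → ¬e (Adj-sym H e′)
  ... | yes v∈S = contradiction
    (subst₂ (Adj H) (sym≡ (fold-∈ hu)) (sym≡ (fold-∉ v∉U))
      (HullAdj⇒Adj-κ (neighbour⇒hull u hu v v∈S v∉U e) (φ∉U u hu) v∉U))
    ¬e

  violated-edge⇒outside : ∀ {u v} → Adj G u v → ¬ Adj H (fold u) (fold v) → ViolatedOutsideEdge
  violated-edge⇒outside {u} {v} e ¬e = by-location (u ∈? U) (v ∈? U)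
    where
    by-location : Dec (u ∈ U) → Dec (v ∈ U) → ViolatedOutsideEdge
    by-location (yes hu)  (yes hv)  = contradiction
      (subst₂ (Adj H) (sym≡ (fold-∈ hu)) (sym≡ (fold-∈ hv))
        (HullAdj⇒Adj-κ (edge⇒hull u v hu hv e) (φ∉U u hu) (φ∉U v hv)))
      ¬e
    by-location (yes hu)  (no v∉U) = violated-edge-from-U⇒outside hu v∉U e ¬e
    by-location (no u∉U) (yes hv)  =
      violated-edge-from-U⇒outside hv u∉U (Adj-sym G e) (λ e′ → ¬e (Adj-sym H e′))
    by-location (no u∉U) (no v∉U) = contradiction
      (subst₂ (Adj H) (sym≡ (fold-∉ u∉U)) (sym≡ (fold-∉ v∉U)) (hom c u v _ _ e))
      ¬e

  violated-outside-edge : ViolatedOutsideEdge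
  violated-outside-edge =
    let u , v , e , ¬e = ¬IsHom⇒violated-edge {G} {H} {fold}
                           (λ fold-hom → proj₁ mo (IsHom⇒HColoring ⊤ fold-hom))
    in violated-edge⇒outside e ¬e

  separating-vertex : ∃ λ x → x ∉ S × ∃ λ u → Σ (u ∈ U) λ hu →
                      Adj G x u × (∀ T → ¬ HullAdj G (T ─ U) H x (φ u hu))
  separating-vertex =
    let x , x∉S , u , hu , e , ¬e = violated-outside-edge
        x∉U = λ x∈U → x∉S (U⊆S x∈U)
    in x , x∉S , u , hu , e , λ T hull →
       ¬e (subst₂ (Adj H) (sym≡ (fold-∉ x∉U)) (sym≡ (fold-∈ hu))
            (HullAdj⇒Adj-κ {T} hull x∉U (φ∉U u hu)))

corollary1 : (H G' : Graph) → MinimalObstruction G' H →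
    (S : Subset (n G')) → Colorable G' S H →
    (U W : Subset (n G')) → U ⊆ S → W ⊆ S → Nonempty U → Nonempty W →
    (∀ v → v ∈ U → v ∉ W) →
    (φ : (u : V G') → u ∈ U → V G') →
    (∀ u (hu : u ∈ U) → φ u hu ∈ W) →
    (∀ u v (hu : u ∈ U) (hv : v ∈ U) → φ u hu ≡ φ v hv → u ≡ v) →
    (∀ w → w ∈ W → ∃ λ u → Σ (u ∈ U) λ hu → φ u hu ≡ w) →
    (∀ u v (hu : u ∈ U) (hv : v ∈ U) →
      Adj G' u v ⇔ HullAdj G' (S ─ U) H (φ u hu) (φ v hv)) →
    (∀ u (hu : u ∈ U) v → v ∈ S → v ∉ U → Adj G' u v →
      HullAdj G' (S ─ U) H (φ u hu) v) →
    ∃ λ x → x ∉ S × ∃ λ u → Σ (u ∈ U) λ hu →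
      Adj G' x u ×
      ¬ HullAdj G' (⊤ ─ U) H x (φ u hu) ×
      ¬ HullAdj G' ((S ∪ ⁅ x ⁆) ─ U) H x (φ u hu)
corollary1 H G' mo S _ U _ U⊆S _ U≢∅ _ U∩W≡∅ φ φ∈W _ _ iso neighbour⇒hull =
  let x , x∉S , u , hu , e , ¬hull = separating-vertex mo U⊆S U≢∅ φ φ∉U edge⇒hull neighbour⇒hull
  in x , x∉S , u , hu , e , ¬hull ⊤ , ¬hull (S ∪ ⁅ x ⁆)
  where
  φ∉U : ∀ u (hu : u ∈ U) → φ u hu ∉ U
  φ∉U u hu φu∈U = U∩W≡∅ _ φu∈U (φ∈W u hu)

  edge⇒hull : ∀ u v (hu : u ∈ U) (hv : v ∈ U) → Adj G' u v →
              HullAdj G' (S ─ U) H (φ u hu) (φ v hv)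
  edge⇒hull u v hu hv = Equivalence.to (iso u v hu hv)
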